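{- Let $n,k\in\mathbb{N}$ and $T\in\operatorname{YT}(n)$. Suppose $m$ is a known entry of a cell $c$ of $T$, and $c$ is an outer corner of $T$. If there exists $T'\in\operatorname{M}_k(T)$ in which the cell $c$ exists (i.e. lies in the Young diagram of $T'$) and is labeled by $m$, then all cells of $T$ with entries less than $m$ (their positions and their entries) are reconstructible from $\operatorname{M}_k(T)$. In particular, $\operatorname{In}(m)$ (with its entries) is reconstructible from $\operatorname{M}_k(T)$.
   Context: $\mathbb{N}=\{1,2,\dots\}$ and $[a,b]$ denotes an integer interval in $\mathbb{N}$. A (standard Young) tableau of shape $\lambda$ (a partition of $n$) is a filling of the left-justified Young diagram of $\lambda$ (rows of lengths $\lambda_1\ge\lambda_2\ge\cdots$ from top) by distinct elements of $[1,n]$ increasing strictly along rows (left to right) and down columns; $\operatorname{YT}(n)$ is the set of such tableaux with entries exactly $[1,n]$. Cells are identified with their entries. An outer corner (OC) of $T$ is a cell that is the rightmost cell of its row and the bottom cell of its column. For a cell $c$ (with entry $m$), $\operatorname{In}(m)=\operatorname{In}(c)$ is the set of cells weakly left of and weakly above $c$. Deletion by jeu de taquin: for $T\in\operatorname{YT}(n)$ and an entry $m$, delete the cell containing $m$, leaving an empty space; repeatedly, if there is a cell directly to the right of or directly below the empty space, slide the one with the smaller entry into the empty space; stop when the empty space has no cell to its right or below it (it is then removed); finally subtract 1 from every entry larger than $m$. The result $T-m\in\operatorname{YT}(n-1)$. A $k$-minor of $T$ is a tableau obtained from $T$ by $k$ successive such deletions (each deleting any cell of the current tableau); $\operatorname{M}_k(T)$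 is the set of all $k$-minors of $T$. "Reconstructible from $\operatorname{M}_k(T)$" means determined by the set $\operatorname{M}_k(T)$ together with the information stated as known in the hypotheses. -}

module Defs where

open import Data.Nat using (ℕ; zero; suc; pred; _<_; _≤_; _<ᵇ_)
open import Data.Nat.ListAction using (sum)
open import Data.Nat.Properties using (_<?_)
open import Data.Bool using (if_then_else_)
open import Data.Maybe using (Maybe; just; nothing)
open import Data.Product using (_×_; _,_; Σ; ∃)
open import Data.List using (List; []; _∷_; length; concat; map; upTo)
open import Data.List.Relation.Unary.All using (All)
open import Data.List.Relation.Unary.Linked using (Linked)
open import Data.List.Relation.Binary.Permutation.Propositional using (_↭_)
open import Relation.Binary.PropositionalEquality using (_≡_)
open import Relation.Nullary using (yes; no)

-- A tableau is stored as its list of rows (top row first), each row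
-- listed left to right.  Cells are indexed by (row, column), 0-based.
Tableau : Set
Tableau = List (List ℕ)

atRow : List ℕ → ℕ → Maybe ℕ
atRow []       _       = nothing
atRow (x ∷ _)  zero    = just x
atRow (_ ∷ xs) (suc j) = atRow xs j

at : Tableau → ℕ → ℕ → Maybe ℕ
at []       _       _ = nothing
at (r ∷ _)  zero    j = atRow r j
at (_ ∷ rs) (suc i) j = at rs i j

size : Tableau → ℕ
size T = sum (map length T)

record IsYT (n : ℕ) (T : Tableau) : Set where
  field
    rowsNonEmpty : All (λ r → 0 < length r) T
    shapePartition : Linked (λ r s → length s ≤ length r) T
    rowsIncreasing : All (Linked _<_) T
    colsIncreasing : ∀ i j x y → at T i j ≡ just x → at T (suc i) j ≡ just y → x < y
    entries : concat T ↭ map suc (upTo n)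

setRow : List ℕ → ℕ → ℕ → List ℕ
setRow []       _       _ = []
setRow (_ ∷ xs) zero    v = v ∷ xs
setRow (x ∷ xs) (suc j) v = x ∷ setRow xs j v

setAt : Tableau → ℕ → ℕ → ℕ → Tableau
setAt []       _       _ _ = []
setAt (r ∷ rs) zero    j v = setRow r j v ∷ rs
setAt (r ∷ rs) (suc i) j v = r ∷ setAt rs i j v

-- remove cell (i, j) of a row (used only when it is the last cell of its row)
removeRow : List ℕ → ℕ → List ℕ
removeRow []       _       = []
removeRow (_ ∷ xs) zero    = xs
removeRow (x ∷ xs) (suc j) = x ∷ removeRow xs j

removeCell : Tableau → ℕ → ℕ → Tableau
removeCell []       _       _ = []
removeCell (r ∷ rs) zero    j with removeRow r j
... | []      = rs
... | x ∷ xs  = (x ∷ xs) ∷ rs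
removeCell (r ∷ rs) (suc i) j = r ∷ removeCell rs i j

-- jeu de taquin slide of the empty space at (i, j); the fuel bounds the
-- number of slides (size T always suffices, since the empty space visits
-- distinct cells of the diagram)
slide : ℕ → Tableau → ℕ → ℕ → Tableau
slide zero    T i j = removeCell T i j
slide (suc f) T i j with at T i (suc j) | at T (suc i) j
... | nothing | nothing = removeCell T i j
... | just r  | nothing = slide f (setAt T i j r) i (suc j)
... | nothing | just b  = slide f (setAt T i j b) (suc i) j
... | just r  | just b  =
  if r <ᵇ b then slide f (setAt T i j r) i (suc j)
            else slide f (setAt T i j b) (suc i) j

decr : ℕ → ℕ → ℕ
decr m x with m <? x
... | yes _ = pred x
... | no _  = x

renumber : ℕ → Tableau → Tableau
renumber m T = map (map (decr m)) T

deleteAt : Tableau → ℕ → ℕ → ℕ → Tableau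
deleteAt T i j m = renumber m (slide (size T) T i j)

Deletion : Tableau → Tableau → Set
Deletion T T' = Σ ℕ λ i → Σ ℕ λ j → Σ ℕ λ m → at T i j ≡ just m × T' ≡ deleteAt T i j m

data IsMinor : ℕ → Tableau → Tableau → Set where
  here : ∀ {T} → IsMinor zero T T
  step : ∀ {k T T' T''} → IsMinor k T T' → Deletion T' T'' → IsMinor (suc k) T T''

IsOC : Tableau → ℕ → ℕ → Set
IsOC T i j = (∃ λ x → at T i j ≡ just x) × at T i (suc j) ≡ nothing × at T (suc i) j ≡ nothing

-- Follow a deletion sequence from T to a minor and watch the outer corner
-- (ci, cj).  Jeu de taquin only moves entries left or up, so the quadrant
-- beyond the corner stays empty and the corner entry is either kept,
-- decreased by renumbering, or vacated; once it is below m it stays below m.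
-- Hence on the way to a minor with m in the corner every deleted entry is at
-- least m.  Such a deletion starts its hole at an entry ≥ m, and the hole only
-- travels right and down, through entries ≥ m, so the cells with entries < m
-- keep their entries and renumbering does not touch them.  Thus T and the
-- minor agree on all entries < m; since T₁ and T₂ share that minor, they
-- agree with each other, and every cell weakly above-left of the corner
-- other than the corner itself holds an entry < m.

module Submission where

open import Defs
open import Data.Nat using (ℕ; zero; suc; pred; _<_; _≤_; z≤n; s≤s; _<ᵇ_)
open import Data.Nat.Properties
open import Data.Maybe using (Maybe; just; nothing; map)
open import Data.Maybe.Properties using (just-injective)
open import Data.Maybe.Relation.Unary.All using (All; just; nothing; drop-just)
open import Data.Product using (_×_; Σ; _,_; proj₁; proj₂; ∃)
open import Data.Sum using (_⊎_; inj₁; inj₂; [_,_]′)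
open import Function using (_∘_)
open import Data.Bool using (true; false)
open import Data.List using ([]; _∷_; length)
import Data.List.Relation.Unary.All as ListAll
open ListAll using (_∷_)
open import Data.List.Relation.Unary.Linked using (Linked; _∷_)
open import Function.Bundles using (_⇔_; mk⇔; Equivalence)
open import Relation.Binary.PropositionalEquality
  using (_≡_; refl; sym; trans; cong; subst; module ≡-Reasoning)
open import Relation.Nullary using (yes; no; contradiction)

below : ℕ → Maybe ℕ → Maybe ℕ
below m nothing  = nothing
below m (just e) with e <? m
... | yes _ = just e
... | no  _ = nothing

below-just-< : ∀ {m e} → e < m → below m (just e) ≡ just e
below-just-< {m} {e} e<m with e <? m
... | yes _   = refl
... | no  e≮m = contradiction e<m e≮m

below-just-≥ : ∀ {m e} → m ≤ e → below m (just e) ≡ nothing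
below-just-≥ {m} {e} m≤e with e <? m
... | yes e<m = contradiction m≤e (<⇒≱ e<m)
... | no  _   = refl

below≡just⇒≡just : ∀ {m e} o → below m o ≡ just e → o ≡ just e
below≡just⇒≡just {m} (just v) h with v <? m
... | yes _ = h

below-id : ∀ {m o} → All (_< m) o → below m o ≡ o
below-id nothing    = refl
below-id (just e<m) = below-just-< e<m

below-≡⇒just⇔ : ∀ {m e} o o' → below m o ≡ below m o' → e < m → (o ≡ just e ⇔ o' ≡ just e)
below-≡⇒just⇔ {m} {e} o o' eq e<m = mk⇔ (transfer o o' eq) (transfer o' o (sym eq))
  where
  transfer : ∀ o o' → below m o ≡ below m o' → o ≡ just e → o' ≡ just e
  transfer o o' eq refl = below≡just⇒≡just o' (trans (sym eq) (below-just-< e<m))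

decr-pred : ∀ {x v} → x < v → decr x v ≡ pred v
decr-pred {x} {v} x<v with x <? v
... | yes _   = refl
... | no  x≮v = contradiction x<v x≮v

decr-id : ∀ {x v} → v ≤ x → decr x v ≡ v
decr-id {x} {v} v≤x with x <? v
... | yes x<v = contradiction v≤x (<⇒≱ x<v)
... | no  _   = refl

decr-< : ∀ {x v} → x < v → decr x v < v
decr-< {v = suc v} x<v rewrite decr-pred x<v = ≤-refl

decr-≤ : ∀ x v → decr x v ≤ v
decr-≤ x v with x <? v
... | yes _ = pred[n]≤n
... | no  _ = ≤-refl

below-decr : ∀ {m x} → m ≤ x → ∀ o → below m (map (decr x) o) ≡ below m o
below-decr m≤x nothing = refl
below-decr {m} {x} m≤x (just v) = [ lower , higher ]′ (≤-<-connex v x)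
  where
  lower : v ≤ x → below m (just (decr x v)) ≡ below m (just v)
  lower v≤x = cong (below m ∘ just) (decr-id v≤x)
  higher : x < v → below m (just (decr x v)) ≡ below m (just v)
  higher x<v = begin
    below m (just (decr x v)) ≡⟨ cong (below m ∘ just) (decr-pred x<v) ⟩
    below m (just (pred v))   ≡⟨ below-just-≥ (≤-trans m≤x (<⇒≤pred x<v)) ⟩
    nothing                   ≡⟨ below-just-≥ (≤-trans m≤x (<⇒≤ x<v)) ⟨
    below m (just v)          ∎
    where open ≡-Reasoning

all<-decr : ∀ {m} x {o} → All (_< m) o → All (_< m) (map (decr x) o)
all<-decr x nothing           = nothing
all<-decr x {just v} (just v<m) = just (≤-<-trans (decr-≤ x v) v<m)

-- Geometry of a tableau

IsCell : Tableau → ℕ → ℕ → Set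
IsCell S a b = ∃ λ x → at S a b ≡ just x

atRow-left : ∀ r {q b y} → q ≤ b → atRow r b ≡ just y → ∃ λ x → atRow r q ≡ just x
atRow-left (x ∷ r) z≤n         _ = x , refl
atRow-left (_ ∷ r) (s≤s q≤b) h = atRow-left r q≤b h

cell-left : ∀ S a {q b y} → q ≤ b → at S a b ≡ just y → IsCell S a q
cell-left (r ∷ S) zero    q≤b h = atRow-left r q≤b h
cell-left (_ ∷ S) (suc a) q≤b h = cell-left S a q≤b h

atRow-length : ∀ r {b y} → atRow r b ≡ just y → b < length r
atRow-length (_ ∷ r) {zero}  _ = s≤s z≤n
atRow-length (_ ∷ r) {suc b} h = s≤s (atRow-length r h)

atRow-of-length : ∀ r {b} → b < length r → ∃ λ y → atRow r b ≡ just y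
atRow-of-length (x ∷ r) {zero}  _         = x , refl
atRow-of-length (_ ∷ r) {suc b} (s≤s b<l) = atRow-of-length r b<l

PartitionShape : Tableau → Set
PartitionShape = Linked (λ r s → length s ≤ length r)

cell-above : ∀ {S} → PartitionShape S → ∀ a {b y} → at S (suc a) b ≡ just y → IsCell S a b
cell-above {r ∷ s ∷ S} (le ∷ _)  zero    h = atRow-of-length r (<-≤-trans (atRow-length s h) le)
cell-above {r ∷ s ∷ S} (_ ∷ sh)  (suc a) h = cell-above sh a h

cell-up : ∀ {S} → PartitionShape S → ∀ {p} a {b y} → p ≤ a → at S a b ≡ just y → IsCell S p b
cell-up sh zero    z≤n h = _ , h
cell-up sh (suc a) p≤a h with m≤n⇒m<n∨m≡n p≤a
... | inj₂ refl        = _ , h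
... | inj₁ (s≤s p≤a') = cell-up sh a p≤a' (proj₂ (cell-above sh a h))

strictMono⇒mono : (f : ℕ → Maybe ℕ) →
  (∀ {q b x y} → q < b → f q ≡ just x → f b ≡ just y → x < y) →
  ∀ {q b x y} → q ≤ b → f q ≡ just x → f b ≡ just y → x ≤ y
strictMono⇒mono f strict q≤b hx hy with m≤n⇒m<n∨m≡n q≤b
... | inj₁ q<b  = <⇒≤ (strict q<b hx hy)
... | inj₂ refl = ≤-reflexive (just-injective (trans (sym hx) hy))

atRow-head-< : ∀ {x} r {b y} → Linked _<_ (x ∷ r) → atRow r b ≡ just y → x < y
atRow-head-< (z ∷ r) {zero}  (x<z ∷ _) refl = x<z
atRow-head-< (z ∷ r) {suc b} (x<z ∷ l) h    = <-trans x<z (atRow-head-< r l h)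

atRow-strictMono : ∀ r → Linked _<_ r →
  ∀ {q b x y} → q < b → atRow r q ≡ just x → atRow r b ≡ just y → x < y
atRow-strictMono (z ∷ r)     l       {zero}  {suc b} _         refl hy = atRow-head-< r l hy
atRow-strictMono (z ∷ w ∷ r) (_ ∷ l) {suc q} {suc b} (s≤s q<b) hx   hy = atRow-strictMono (w ∷ r) l q<b hx hy

at-rowStrictMono : ∀ S → ListAll.All (Linked _<_) S → ∀ a →
  ∀ {q b x y} → q < b → at S a q ≡ just x → at S a b ≡ just y → x < y
at-rowStrictMono (r ∷ S) (l ∷ _)  zero    = atRow-strictMono r l
at-rowStrictMono (_ ∷ S) (_ ∷ ls) (suc a) = at-rowStrictMono S ls a

module YoungTableau {n T} (yt : IsYT n T) where
  open IsYT yt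

  cell-up-left : ∀ {p q a b y} → p ≤ a → q ≤ b → at T a b ≡ just y → IsCell T p q
  cell-up-left {a = a} p≤a q≤b h = cell-left T _ q≤b (proj₂ (cell-up shapePartition a p≤a h))

  row-< : ∀ a {q b x y} → q < b → at T a q ≡ just x → at T a b ≡ just y → x < y
  row-< = at-rowStrictMono T rowsIncreasing

  row-≤ : ∀ a {q b x y} → q ≤ b → at T a q ≡ just x → at T a b ≡ just y → x ≤ y
  row-≤ a = strictMono⇒mono (at T a) (row-< a)

  col-< : ∀ b {p a x y} → p < a → at T p b ≡ just x → at T a b ≡ just y → x < y
  col-< b {p} {suc a} (s≤s p≤a) hx hy with cell-above shapePartition a hy
  ... | z , hz with m≤n⇒m<n∨m≡n p≤a
  ...   | inj₂ refl = colsIncreasing p b _ _ hx hy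
  ...   | inj₁ p<a  = <-trans (col-< b p<a hx hz) (colsIncreasing a b _ _ hz hy)

  col-≤ : ∀ b {p a x y} → p ≤ a → at T p b ≡ just x → at T a b ≡ just y → x ≤ y
  col-≤ b = strictMono⇒mono (λ p → at T p b) (col-< b)

  entry-< : ∀ {p q a b x y} → p ≤ a → q ≤ b → p < a ⊎ q < b →
    at T p q ≡ just x → at T a b ≡ just y → x < y
  entry-< {p} {q} {a} {b} p≤a q≤b before hx hy with cell-up shapePartition a p≤a hy
  ... | z , hz with before
  ...   | inj₁ p<a = ≤-<-trans (row-≤ p q≤b hx hz) (col-< b p<a hz hy)
  ...   | inj₂ q<b = <-≤-trans (row-< p q<b hx hz) (col-≤ b p≤a hz hy)

  entry-≤ : ∀ {p q a b x y} → p ≤ a → q ≤ b → at T p q ≡ just x → at T a b ≡ just y → x ≤ y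
  entry-≤ {p} {a = a} p≤a q≤b hx hy with cell-up shapePartition a p≤a hy
  ... | z , hz = ≤-trans (row-≤ p q≤b hx hz) (col-≤ _ p≤a hz hy)

  before-corner-< : ∀ {ci cj m} → at T ci cj ≡ just m →
    ∀ {i j} → i ≤ ci → j ≤ cj → i < ci ⊎ j < cj → All (_< m) (at T i j)
  before-corner-< atM {i} {j} i≤ci j≤cj before with at T i j in eq
  ... | nothing = nothing
  ... | just _  = just (entry-< i≤ci j≤cj before eq atM)

atRow-setRow : ∀ r q v b → atRow (setRow r q v) b ≡ atRow r b ⊎ (b ≡ q × atRow (setRow r q v) b ≡ just v)
atRow-setRow []      q       v b       = inj₁ refl
atRow-setRow (x ∷ r) zero    v zero    = inj₂ (refl , refl)
atRow-setRow (x ∷ r) zero    v (suc b) = inj₁ refl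
atRow-setRow (x ∷ r) (suc q) v zero    = inj₁ refl
atRow-setRow (x ∷ r) (suc q) v (suc b) with atRow-setRow r q v b
... | inj₁ h          = inj₁ h
... | inj₂ (refl , h) = inj₂ (refl , h)

at-setAt : ∀ S p q v a b →
  at (setAt S p q v) a b ≡ at S a b ⊎ (a ≡ p × b ≡ q × at (setAt S p q v) a b ≡ just v)
at-setAt []      p       q v a       b = inj₁ refl
at-setAt (r ∷ S) zero    q v zero    b with atRow-setRow r q v b
... | inj₁ h          = inj₁ h
... | inj₂ (refl , h) = inj₂ (refl , refl , h)
at-setAt (r ∷ S) zero    q v (suc a) b = inj₁ refl
at-setAt (r ∷ S) (suc p) q v zero    b = inj₁ refl
at-setAt (r ∷ S) (suc p) q v (suc a) b with at-setAt S p q v a b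
... | inj₁ h                 = inj₁ h
... | inj₂ (refl , refl , h) = inj₂ (refl , refl , h)

at-renumber : ∀ x S a b → at (renumber x S) a b ≡ map (decr x) (at S a b)
at-renumber x []      a       b = refl
at-renumber x (r ∷ S) zero    b = atRow-map r b
  where
  atRow-map : ∀ r b → atRow (Data.List.map (decr x) r) b ≡ map (decr x) (atRow r b)
  atRow-map []      b       = refl
  atRow-map (_ ∷ r) zero    = refl
  atRow-map (_ ∷ r) (suc b) = atRow-map r b
at-renumber x (_ ∷ S) (suc a) b = at-renumber x S a b

data RemoveCellView (S : Tableau) (p q a b : ℕ) : Set where
  unchanged   : at (removeCell S p q) a b ≡ at S a b → RemoveCellView S p q a b
  shiftedLeft : a ≡ p → q ≤ b → at (removeCell S p q) a b ≡ at S a (suc b) →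
                RemoveCellView S p q a b
  shiftedUp   : p ≤ a → q ≡ 0 ⊎ at S p 0 ≡ nothing →
                at (removeCell S p q) a b ≡ at S (suc a) b → RemoveCellView S p q a b

atRow-removeRow-< : ∀ r {q b} → b < q → atRow (removeRow r q) b ≡ atRow r b
atRow-removeRow-< []      _         = refl
atRow-removeRow-< (x ∷ r) {suc q} {zero}  _         = refl
atRow-removeRow-< (x ∷ r) {suc q} {suc b} (s≤s b<q) = atRow-removeRow-< r b<q

atRow-removeRow-≥ : ∀ r {q b} → q ≤ b → atRow (removeRow r q) b ≡ atRow r (suc b)
atRow-removeRow-≥ []      _         = refl
atRow-removeRow-≥ (x ∷ r) z≤n       = refl
atRow-removeRow-≥ (x ∷ r) (s≤s q≤b) = atRow-removeRow-≥ r q≤b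

removeRow≡[] : ∀ r q → removeRow r q ≡ [] → q ≡ 0 ⊎ atRow r 0 ≡ nothing
removeRow≡[] []      q    _ = inj₂ refl
removeRow≡[] (x ∷ r) zero _ = inj₁ refl

removeCell-zero : ∀ r S q →
  removeRow r q ≡ [] × removeCell (r ∷ S) 0 q ≡ S ⊎ removeCell (r ∷ S) 0 q ≡ removeRow r q ∷ S
removeCell-zero r S q with removeRow r q
... | []    = inj₁ (refl , refl)
... | _ ∷ _ = inj₂ refl

removeCell-view : ∀ S p q a b → RemoveCellView S p q a b
removeCell-view []      p q a b = unchanged refl
removeCell-view (r ∷ S) zero q a b with removeCell-zero r S q
... | inj₁ (emptied , eq) = shiftedUp z≤n (removeRow≡[] r q emptied) (cong (λ S' → at S' a b) eq)
... | inj₂ eq with a | b <? q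
...   | suc a | _       = unchanged (cong (λ S' → at S' (suc a) b) eq)
...   | zero  | yes b<q = unchanged (trans (cong (λ S' → at S' 0 b) eq) (atRow-removeRow-< r b<q))
...   | zero  | no  b≮q =
  shiftedLeft refl (≮⇒≥ b≮q) (trans (cong (λ S' → at S' 0 b) eq) (atRow-removeRow-≥ r (≮⇒≥ b≮q)))
removeCell-view (r ∷ S) (suc p) q zero    b = unchanged refl
removeCell-view (r ∷ S) (suc p) q (suc a) b with removeCell-view S p q a b
... | unchanged h          = unchanged h
... | shiftedLeft refl q≤b h = shiftedLeft refl q≤b h
... | shiftedUp p≤a row h  = shiftedUp (s≤s p≤a) row h

module _ (P : Tableau → ℕ → ℕ → Set) (Q : Tableau → Set)
         (stop  : ∀ S p q → P S p q → Q (removeCell S p q))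
         (right : ∀ S p q {r} → at S p (suc q) ≡ just r → P S p q → P (setAt S p q r) p (suc q))
         (down  : ∀ S p q {r} → at S (suc p) q ≡ just r → P S p q → P (setAt S p q r) (suc p) q)
  where

  slide-induction : ∀ f {S p q} → P S p q → Q (slide f S p q)
  slide-induction zero {S} {p} {q} h = stop S p q h
  slide-induction (suc f) {S} {p} {q} h with at S p (suc q) in eʳ | at S (suc p) q in eᵈ
  ... | nothing | nothing = stop S p q h
  ... | just r  | nothing = slide-induction f (right S p q eʳ h)
  ... | nothing | just b  = slide-induction f (down S p q eᵈ h)
  ... | just r  | just b with r <ᵇ b
  ...   | true  = slide-induction f (right S p q eʳ h)
  ...   | false = slide-induction f (down S p q eᵈ h)

-- The quadrant beyond a cell

EmptyBeyond : ℕ → ℕ → Tableau → Set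
EmptyBeyond ci cj S = ∀ a b → ci ≤ a → cj ≤ b → ci < a ⊎ cj < b → at S a b ≡ nothing

KeptOrVacated : Tableau → Tableau → ℕ → ℕ → Set
KeptOrVacated S S' a b = at S' a b ≡ at S a b ⊎ at S' a b ≡ nothing

module _ {ci cj : ℕ} where

  right-of-beyond : ∀ S {a b} → EmptyBeyond ci cj S → ci ≤ a → cj ≤ b → at S a (suc b) ≡ nothing
  right-of-beyond _ eb ci≤a cj≤b = eb _ _ ci≤a (m≤n⇒m≤1+n cj≤b) (inj₂ (s≤s cj≤b))

  below-beyond : ∀ S {a b} → EmptyBeyond ci cj S → ci ≤ a → cj ≤ b → at S (suc a) b ≡ nothing
  below-beyond _ eb ci≤a cj≤b = eb _ _ (m≤n⇒m≤1+n ci≤a) cj≤b (inj₁ (s≤s ci≤a))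

  setAt-keeps-quadrant : ∀ {S p q v a b} → EmptyBeyond ci cj S →
    IsCell S p (suc q) ⊎ IsCell S (suc p) q →
    ci ≤ a → cj ≤ b → at (setAt S p q v) a b ≡ at S a b
  setAt-keeps-quadrant {S} {p} {q} {v} {a} {b} eb neighbour ci≤a cj≤b with at-setAt S p q v a b
  ... | inj₁ h                 = h
  ... | inj₂ (refl , refl , _) with neighbour
  ...   | inj₁ (_ , h) = contradiction (trans (sym h) (right-of-beyond S eb ci≤a cj≤b)) λ ()
  ...   | inj₂ (_ , h) = contradiction (trans (sym h) (below-beyond S eb ci≤a cj≤b)) λ ()

  removeCell-emptyBeyond : ∀ {S p q} → EmptyBeyond ci cj S →
    EmptyBeyond ci cj (removeCell S p q) × KeptOrVacated S (removeCell S p q) ci cj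
  removeCell-emptyBeyond {S} {p} {q} eb = beyond , corner
    where
    beyond : EmptyBeyond ci cj (removeCell S p q)
    beyond a b ci≤a cj≤b past with removeCell-view S p q a b
    ... | unchanged h         = trans h (eb a b ci≤a cj≤b past)
    ... | shiftedLeft _ _ h   = trans h (right-of-beyond S eb ci≤a cj≤b)
    ... | shiftedUp _ _ h     = trans h (below-beyond S eb ci≤a cj≤b)
    corner : KeptOrVacated S (removeCell S p q) ci cj
    corner with removeCell-view S p q ci cj
    ... | unchanged h       = inj₁ h
    ... | shiftedLeft _ _ h = inj₂ (trans h (right-of-beyond S eb ≤-refl ≤-refl))
    ... | shiftedUp _ _ h   = inj₂ (trans h (below-beyond S eb ≤-refl ≤-refl))

  slide-emptyBeyond : ∀ f {S p q} → EmptyBeyond ci cj S →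
    EmptyBeyond ci cj (slide f S p q) × KeptOrVacated S (slide f S p q) ci cj
  slide-emptyBeyond f {S} eb = slide-induction Keeps Result stop right down f (eb , refl)
    where
    Keeps : Tableau → ℕ → ℕ → Set
    Keeps S' _ _ = EmptyBeyond ci cj S' × at S' ci cj ≡ at S ci cj
    Result : Tableau → Set
    Result S' = EmptyBeyond ci cj S' × KeptOrVacated S S' ci cj
    stop : ∀ S' p q → Keeps S' p q → Result (removeCell S' p q)
    stop S' p q (eb' , same) with removeCell-emptyBeyond {S'} {p} {q} eb'
    ... | eb'' , inj₁ h = eb'' , inj₁ (trans h same)
    ... | eb'' , inj₂ h = eb'' , inj₂ h
    moved : ∀ S' p q {r} → IsCell S' p (suc q) ⊎ IsCell S' (suc p) q →
      Keeps S' p q → EmptyBeyond ci cj (setAt S' p q r) × at (setAt S' p q r) ci cj ≡ at S ci cj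
    moved S' p q {r} neighbour (eb' , same) =
        (λ a b ci≤a cj≤b past → trans (keeps ci≤a cj≤b) (eb' a b ci≤a cj≤b past))
      , trans (keeps ≤-refl ≤-refl) same
      where
      keeps : ∀ {a b} → ci ≤ a → cj ≤ b → at (setAt S' p q r) a b ≡ at S' a b
      keeps = setAt-keeps-quadrant {S'} {p} {q} {r} eb' neighbour
    right : ∀ S' p q {r} → at S' p (suc q) ≡ just r → Keeps S' p q → Keeps (setAt S' p q r) p (suc q)
    right S' p q h = moved S' p q (inj₁ (_ , h))
    down : ∀ S' p q {r} → at S' (suc p) q ≡ just r → Keeps S' p q → Keeps (setAt S' p q r) (suc p) q
    down S' p q h = moved S' p q (inj₂ (_ , h))

  renumber-emptyBeyond : ∀ x {S} → EmptyBeyond ci cj S → EmptyBeyond ci cj (renumber x S)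
  renumber-emptyBeyond x {S} eb a b ci≤a cj≤b past =
    trans (at-renumber x S a b) (cong (map (decr x)) (eb a b ci≤a cj≤b past))

-- Agreement on the entries below m

Agrees : ℕ → Tableau → Tableau → Set
Agrees m T S = ∀ a b → below m (at S a b) ≡ below m (at T a b)

NoEntryBelow : ℕ → Tableau → ℕ → ℕ → Set
NoEntryBelow m T a b = below m (at T a b) ≡ nothing

below-just≡nothing⇒≥ : ∀ {m e} → below m (just e) ≡ nothing → m ≤ e
below-just≡nothing⇒≥ {m} {e} h with e <? m
... | no e≮m = ≮⇒≥ e≮m

renumber-agrees : ∀ {m x T S} → m ≤ x → Agrees m T S → Agrees m T (renumber x S)
renumber-agrees {m} {x} {T} {S} m≤x agree a b = begin
  below m (at (renumber x S) a b)   ≡⟨ cong (below m) (at-renumber x S a b) ⟩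
  below m (map (decr x) (at S a b)) ≡⟨ below-decr m≤x (at S a b) ⟩
  below m (at S a b)                ≡⟨ agree a b ⟩
  below m (at T a b)                ∎
  where open ≡-Reasoning

module Agreement {n T} (yt : IsYT n T) (m : ℕ) where
  open YoungTableau yt

  noEntryBelow-mono : ∀ {p q a b} → NoEntryBelow m T p q → p ≤ a → q ≤ b → NoEntryBelow m T a b
  noEntryBelow-mono {p} {q} {a} {b} hole p≤a q≤b with at T a b in eq
  ... | nothing = refl
  ... | just y with cell-up-left p≤a q≤b eq
  ...   | x , hx = below-just-≥ (≤-trans m≤x (entry-≤ p≤a q≤b hx eq))
    where
    m≤x : m ≤ x
    m≤x = below-just≡nothing⇒≥ (trans (cong (below m) (sym hx)) hole)

  setAt-agrees : ∀ {S p q v} → Agrees m T S → NoEntryBelow m T p q → below m (just v) ≡ nothing →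
    Agrees m T (setAt S p q v)
  setAt-agrees {S} {p} {q} {v} agree hole large a b with at-setAt S p q v a b
  ... | inj₁ h                 = trans (cong (below m) h) (agree a b)
  ... | inj₂ (refl , refl , h) = trans (cong (below m) h) (trans large (sym hole))

  emptied-row-hole : ∀ S {p q} → Agrees m T S → NoEntryBelow m T p q → q ≡ 0 ⊎ at S p 0 ≡ nothing →
    NoEntryBelow m T p 0
  emptied-row-hole S agree hole (inj₁ refl)  = hole
  emptied-row-hole S agree hole (inj₂ empty) = trans (sym (agree _ 0)) (cong (below m) empty)

  removeCell-agrees : ∀ {S p q} → Agrees m T S → NoEntryBelow m T p q → Agrees m T (removeCell S p q)
  removeCell-agrees {S} {p} {q} agree hole a b = fromView (removeCell-view S p q a b)
    where
    vacant : ∀ {a' b'} → at (removeCell S p q) a b ≡ at S a' b' →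
      NoEntryBelow m T a' b' → NoEntryBelow m T a b → below m (at (removeCell S p q) a b) ≡ below m (at T a b)
    vacant {a'} {b'} h hole' hole'' = trans (cong (below m) h) (trans (agree a' b') (trans hole' (sym hole'')))
    fromView : RemoveCellView S p q a b → below m (at (removeCell S p q) a b) ≡ below m (at T a b)
    fromView (unchanged h)            = trans (cong (below m) h) (agree a b)
    fromView (shiftedLeft refl q≤b h) =
      vacant h (noEntryBelow-mono hole ≤-refl (m≤n⇒m≤1+n q≤b)) (noEntryBelow-mono hole ≤-refl q≤b)
    fromView (shiftedUp p≤a emptied h) =
      vacant h (noEntryBelow-mono hole₀ (m≤n⇒m≤1+n p≤a) z≤n) (noEntryBelow-mono hole₀ p≤a z≤n)
      where
      hole₀ : NoEntryBelow m T p 0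
      hole₀ = emptied-row-hole S agree hole emptied

  slide-agrees : ∀ f {S p q} → Agrees m T S → NoEntryBelow m T p q → Agrees m T (slide f S p q)
  slide-agrees f agree hole = slide-induction AgreesWithHole (Agrees m T) stop right down f (agree , hole)
    where
    AgreesWithHole : Tableau → ℕ → ℕ → Set
    AgreesWithHole S p q = Agrees m T S × NoEntryBelow m T p q
    stop : ∀ S p q → AgreesWithHole S p q → Agrees m T (removeCell S p q)
    stop S _ _ (agree , hole) = removeCell-agrees {S} agree hole
    moved : ∀ S p q {r p' q'} → at S p' q' ≡ just r → p ≤ p' → q ≤ q' →
      AgreesWithHole S p q → AgreesWithHole (setAt S p q r) p' q'
    moved S p q {r} {p'} {q'} h p≤p' q≤q' (agree , hole) =
      setAt-agrees {S} agree hole (trans (cong (below m) (sym h)) (trans (agree p' q') hole')) , hole'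
      where
      hole' : NoEntryBelow m T p' q'
      hole' = noEntryBelow-mono hole p≤p' q≤q'
    right : ∀ S p q {r} → at S p (suc q) ≡ just r → AgreesWithHole S p q → AgreesWithHole (setAt S p q r) p (suc q)
    right S p q h = moved S p q h ≤-refl (n≤1+n q)
    down : ∀ S p q {r} → at S (suc p) q ≡ just r → AgreesWithHole S p q → AgreesWithHole (setAt S p q r) (suc p) q
    down S p q h = moved S p q h (n≤1+n p) ≤-refl

-- Minors keeping m in an outer corner

module Minors {n T} (yt : IsYT n T) (ci cj m : ℕ) where
  open YoungTableau yt
  open Agreement yt m

  outerCorner-emptyBeyond : IsOC T ci cj → EmptyBeyond ci cj T
  outerCorner-emptyBeyond (_ , noRight , noBelow) a b ci≤a cj≤b past with at T a b in eq
  ... | nothing = refl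
  ... | just _ with past
  ...   | inj₁ ci<a = contradiction (trans (sym (proj₂ (cell-up-left ci<a cj≤b eq))) noBelow) λ ()
  ...   | inj₂ cj<b = contradiction (trans (sym (proj₂ (cell-up-left ci≤a cj<b eq))) noRight) λ ()

  Intact : Tableau → Set
  Intact S = Agrees m T S × at S ci cj ≡ just m

  Spoiled : Tableau → Set
  Spoiled S = All (_< m) (at S ci cj)

  Invariant : Tableau → Set
  Invariant S = EmptyBeyond ci cj S × (Intact S ⊎ Spoiled S)

  deletion-invariant : ∀ {S S'} → Invariant S → Deletion S S' → Invariant S'
  deletion-invariant {S} (eb , status) (i , j , x , hx , refl) =
    renumber-emptyBeyond x {R} (proj₁ slid) , status-after status (proj₂ slid)
    where
    R : Tableau
    R = slide (size S) S i j
    slid : EmptyBeyond ci cj R × KeptOrVacated S R ci cj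
    slid = slide-emptyBeyond (size S) {S} {i} {j} eb
    corner : at (renumber x R) ci cj ≡ map (decr x) (at R ci cj)
    corner = at-renumber x R ci cj
    spoiled : All (_< m) (at R ci cj) → Spoiled (renumber x R)
    spoiled small = subst (All (_< m)) (sym corner) (all<-decr x small)
    status-after : Intact S ⊎ Spoiled S → KeptOrVacated S R ci cj → Intact (renumber x R) ⊎ Spoiled (renumber x R)
    status-after _                  (inj₂ vacated) = inj₂ (spoiled (subst (All (_< m)) (sym vacated) nothing))
    status-after (inj₂ small)       (inj₁ kept)    = inj₂ (spoiled (subst (All (_< m)) (sym kept) small))
    status-after (inj₁ (agree , atM)) (inj₁ kept) with x <? m
    ... | yes x<m = inj₂ (subst (All (_< m)) (sym cornerValue) (just (decr-< x<m)))
      where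
      cornerValue : at (renumber x R) ci cj ≡ just (decr x m)
      cornerValue = trans corner (cong (map (decr x)) (trans kept atM))
    ... | no  x≮m = inj₁ (renumber-agrees {T = T} {S = R} m≤x (slide-agrees (size S) {S} agree hole) , cornerValue)
      where
      m≤x : m ≤ x
      m≤x = ≮⇒≥ x≮m
      hole : NoEntryBelow m T i j
      hole = trans (sym (agree i j)) (trans (cong (below m) hx) (below-just-≥ m≤x))
      cornerValue : at (renumber x R) ci cj ≡ just m
      cornerValue = trans corner (trans (cong (map (decr x)) (trans kept atM)) (cong just (decr-id m≤x)))

  minor-invariant : ∀ {k S} → Invariant T → IsMinor k T S → Invariant S
  minor-invariant inv here           = inv
  minor-invariant inv (step {T' = S} minor d) = deletion-invariant {S} (minor-invariant inv minor) d

  minor-agrees : ∀ {k S} → IsOC T ci cj → at T ci cj ≡ just m → IsMinor k T S → at S ci cj ≡ just m →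
    Agrees m T S
  minor-agrees oc atM minor atM' with minor-invariant (outerCorner-emptyBeyond oc , inj₁ ((λ _ _ → refl) , atM)) minor
  ... | _ , inj₁ (agree , _) = agree
  ... | _ , inj₂ small       = contradiction (drop-just (subst (All (_< m)) atM' small)) (<-irrefl refl)

lemma3p1 : (n k : ℕ) (T₁ T₂ : Tableau) (ci cj m : ℕ) →
    IsYT n T₁ → IsYT n T₂ →
    at T₁ ci cj ≡ just m → at T₂ ci cj ≡ just m →
    IsOC T₁ ci cj → IsOC T₂ ci cj →
    (∀ T' → IsMinor k T₁ T' ⇔ IsMinor k T₂ T') →
    Σ Tableau (λ T' → IsMinor k T₁ T' × at T' ci cj ≡ just m) →
    (∀ i j e → e < m → (at T₁ i j ≡ just e ⇔ at T₂ i j ≡ just e))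
    × (∀ i j → i ≤ ci → j ≤ cj → at T₁ i j ≡ at T₂ i j)
lemma3p1 n k T₁ T₂ ci cj m yt₁ yt₂ atM₁ atM₂ oc₁ oc₂ sameMinors (T' , minor₁ , atM') =
  (λ i j e e<m → below-≡⇒just⇔ (at T₁ i j) (at T₂ i j) (small-agree i j) e<m) , inside-corner
  where
  small-agree : ∀ a b → below m (at T₁ a b) ≡ below m (at T₂ a b)
  small-agree a b = trans (sym (Minors.minor-agrees yt₁ ci cj m oc₁ atM₁ minor₁ atM' a b))
                          (Minors.minor-agrees yt₂ ci cj m oc₂ atM₂ (Equivalence.to (sameMinors T') minor₁) atM' a b)
  agree-before-corner : ∀ {i j} → i ≤ ci → j ≤ cj → i < ci ⊎ j < cj → at T₁ i j ≡ at T₂ i j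
  agree-before-corner {i} {j} i≤ci j≤cj before = begin
    at T₁ i j          ≡⟨ below-id (YoungTableau.before-corner-< yt₁ atM₁ i≤ci j≤cj before) ⟨
    below m (at T₁ i j) ≡⟨ small-agree i j ⟩
    below m (at T₂ i j) ≡⟨ below-id (YoungTableau.before-corner-< yt₂ atM₂ i≤ci j≤cj before) ⟩
    at T₂ i j          ∎
    where open ≡-Reasoning
  inside-corner : ∀ i j → i ≤ ci → j ≤ cj → at T₁ i j ≡ at T₂ i j
  inside-corner i j i≤ci j≤cj with m≤n⇒m<n∨m≡n i≤ci | m≤n⇒m<n∨m≡n j≤cj
  ... | inj₂ refl | inj₂ refl = trans atM₁ (sym atM₂)
  ... | inj₁ i<ci | _         = agree-before-corner i≤ci j≤cj (inj₁ i<ci)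
  ... | inj₂ _    | inj₁ j<cj = agree-before-corner i≤ci j≤cj (inj₂ j<cj)
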